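{- Let $G$ be a non-complete graph on $n$ vertices and let $\overline{G}$ denote its complement. Then $$\mathrm{box}(G)\ge \frac{|E(\overline{G})|}{\sum_{i=1}^{n-1} c_v(i,\overline{G})}.$$
   Context: Graphs are finite, simple and undirected. The boxicity $\mathrm{box}(G)$ is the minimum $k$ such that there are interval graphs $I_1,\dots,I_k$ on $V(G)$ with $E(G)=E(I_1)\cap\cdots\cap E(I_k)$ (equivalently, the minimum dimension $b$ such that $G$ is an intersection graph of axis-parallel boxes in $\mathbb{R}^b$). For a graph $H=(V,E)$ and $X\subseteq V$, the strong vertex-boundary is $\mathrm{sn}(X,H)=\{u\in V\setminus X : uv\in E \text{ for all } v\in X\}$, and for a positive integer $k$, $c_v(k,H)=\max_{X\subseteq V,\,|X|=k}|\mathrm{sn}(X,H)|$. -}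

module Defs where

open import Data.Nat using (ℕ; zero; suc; _+_; _*_; _∸_; _≤_; _⊔_)
open import Data.Bool using (Bool; true; false; not; _∧_; _∨_; if_then_else_)
open import Data.Fin using (Fin; toℕ; _≟_)
open import Data.Bool.ListAction using (and)
open import Data.Fin.Subset using (Subset; ∣_∣)
open import Data.Vec using (Vec; []; _∷_; tabulate; lookup)
open import Data.List using (List; []; _∷_; map; foldr; filter; filterᵇ; upTo; allFin; concatMap; _++_; length)
import Data.List as L
open import Data.Product using (Σ; ∃; _×_; _,_)
open import Relation.Nullary using (¬_; does)
open import Relation.Binary.PropositionalEquality using (_≡_; _≢_)
open import Function.Bundles using (_⇔_)
open import Data.Nat.Properties using () renaming (_≟_ to _≟ℕ_)

record SimpleGraph (n : ℕ) : Set where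
  field
    adj    : Fin n → Fin n → Bool
    sym    : ∀ u v → adj u v ≡ adj v u
    irrefl : ∀ u → adj u u ≡ false
open SimpleGraph public

complAdj : ∀ {n} → SimpleGraph n → Fin n → Fin n → Bool
complAdj G u v = if does (u ≟ v) then false else not (adj G u v)

NonComplete : ∀ {n} → SimpleGraph n → Set
NonComplete G = Σ _ λ u → Σ _ λ v → (u ≢ v) × (adj G u v ≡ false)

edgeCount : ∀ {n} → (Fin n → Fin n → Bool) → ℕ
edgeCount {n} a =
  length (filterᵇ (λ p → a (Data.Product.proj₁ p) (Data.Product.proj₂ p))
    (filter (λ p → Data.Nat._<?_ (toℕ (Data.Product.proj₁ p)) (toℕ (Data.Product.proj₂ p)))
      (concatMap (λ u → map (λ v → (u , v)) (allFin n)) (allFin n))))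

allSubsets : ∀ n → List (Subset n)
allSubsets zero    = [] ∷ []
allSubsets (suc n) = map (true ∷_) (allSubsets n) ++ map (false ∷_) (allSubsets n)

sn : ∀ {n} → Subset n → (Fin n → Fin n → Bool) → Subset n
sn {n} X a = tabulate λ u →
  not (lookup X u) ∧ and (map (λ v → not (lookup X v) ∨ a u v) (allFin n))

-- c_v(k,H) = max over X ⊆ V with |X| = k of |sn(X,H)|  (0 if no such X).
cv : ∀ {n} → ℕ → (Fin n → Fin n → Bool) → ℕ
cv {n} k a =
  foldr _⊔_ 0 (map (λ X → ∣ sn X a ∣) (filter (λ X → ∣ X ∣ ≟ℕ k) (allSubsets n)))

cvSum : ∀ {n} → (Fin n → Fin n → Bool) → ℕ
cvSum {n} a = foldr _+_ 0 (map (λ i → cv (suc i) a) (upTo (n ∸ 1)))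

-- Interval graph: closed intervals [l v, r v] (finitely many endpoints, so
-- natural-number endpoints suffice), distinct u,v adjacent iff intervals meet.
IsIntervalGraph : ∀ {n} → SimpleGraph n → Set
IsIntervalGraph {n} I =
  Σ (Fin n → ℕ) λ l → Σ (Fin n → ℕ) λ r →
    (∀ v → l v ≤ r v) ×
    (∀ u v → u ≢ v → (adj I u v ≡ true ⇔ (l u ≤ r v × l v ≤ r u)))

BoxicityAtMost : ∀ {n} → SimpleGraph n → ℕ → Set
BoxicityAtMost {n} G k =
  Σ (Fin k → SimpleGraph n) λ I →
    (∀ j → IsIntervalGraph (I j)) ×
    (∀ u v → u ≢ v → (adj G u v ≡ true ⇔ (∀ j → adj (I j) u v ≡ true)))

{-# OPTIONS --safe #-}
-- Let Ḡ be the complement of G and take a representation of G by k interval graphs, vertex v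
-- having the interval [l_j v, r_j v] in the j-th one. An edge uv of Ḡ is a non-edge of G, so in
-- some factor j the intervals of u and v are disjoint; hence |E(Ḡ)| is at most the sum over j of
-- the number of ordered pairs (u, x) with r_j u < l_j x. Fix j and order the vertices by right
-- endpoint, ties broken by index; let X_u be the set of vertices up to u. A vertex x whose
-- interval starts after r_j u lies outside X_u and its interval misses those of all of X_u, so
-- x ∈ sn(X_u, Ḡ). The sets X_u have the n distinct sizes 1, …, n, so factor j contributes at most
-- Σ_{i=1}^{n} c_v(i, Ḡ), and c_v(n, Ḡ) = 0.
module Submission where

open import Defs hiding (sym)
open import Data.Nat using (ℕ; zero; suc; _+_; _*_; _∸_; _≤_; _<_; _⊔_; z≤n; >-nonZero)
open import Data.Nat.Properties
open import Data.Bool using (Bool; true; false; not; _∧_; _∨_; T; if_then_else_)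
import Data.Bool as Bool
open import Data.Bool.Properties using (T-≡; not-¬; ¬-not)
open import Data.Bool.ListAction using (and)
open import Data.Fin using (Fin; zero; suc; toℕ; fromℕ; fromℕ<; punchIn; punchOut; inject₁)
  renaming (_≟_ to _≟ᶠ_)
import Data.Fin.Properties as Finₚ
open import Data.Fin.Subset using (Subset; ∣_∣; _∈_; _∉_; _⊆_; ∁; ⁅_⁆)
open import Data.Fin.Subset.Properties
  using (p⊆q⇒∣p∣≤∣q∣; p⊂q⇒∣p∣<∣q∣; ∣p∣≤n; ∣∁p∣≡n∸∣p∣; ∣⁅x⁆∣≡1; x∈⁅y⁆⇒x≡y; x∉p⇒x∈∁p)
open import Data.Vec using ([]; _∷_; tabulate; lookup)
open import Data.Vec.Properties using (lookup∘tabulate; lookup⇒[]=; []=⇒lookup)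
open import Data.List using (List; []; _∷_; map; filter; filterᵇ; concatMap; allFin; applyUpTo; length; _++_)
import Data.List as List
open import Data.List.Properties using (map-++; map-∘; map-tabulate; foldr-preservesᵇ; foldr-preservesᵒ)
open import Data.List.Membership.Propositional using () renaming (_∈_ to _∈ˡ_)
open import Data.List.Membership.Propositional.Properties using (∈-filter⁺; ∈-map⁺; ∈-++⁺ˡ; ∈-++⁺ʳ)
open import Data.List.Relation.Unary.Any as Any using (here)
import Data.List.Relation.Unary.All as All
open import Data.List.Relation.Unary.All.Properties using (all⁻; all-filter; map⁺)
import Data.Nat.ListAction as Listℕ
open import Data.Nat.ListAction.Properties using (sum-++)
open import Data.Product using (_×_; _,_; proj₁; proj₂; ∃)
open import Data.Sum using (_⊎_; inj₁; inj₂)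
open import Function using (_∘_; id; _⇔_; mk⇔; Injective)
open import Function.Bundles using (Equivalence)
open import Relation.Nullary using (Dec; yes; no; does; ¬_; contradiction)
open import Relation.Nullary.Decidable using (dec-true; dec-false)
open import Relation.Unary using (Pred; Decidable)
open import Relation.Binary.Definitions using (tri<; tri≈; tri>)
open import Relation.Binary.PropositionalEquality
open import Algebra.Properties.CommutativeMonoid.Sum +-0-commutativeMonoid
  using (sum-syntax; ∑-comm; ∑-distrib-+; sum-remove; sum-cong-≗; sum-init-last)

𝟙 : Bool → ℕ
𝟙 true  = 1
𝟙 false = 0

𝟙-yes : ∀ {p} {P : Set p} (P? : Dec P) → P → 𝟙 (does P?) ≡ 1
𝟙-yes P? p = cong 𝟙 (dec-true P? p)

∑-mono-≤ : ∀ {n} {f g : Fin n → ℕ} → (∀ i → f i ≤ g i) → ∑[ i < n ] f i ≤ ∑[ i < n ] g i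
∑-mono-≤ {zero}  _   = z≤n
∑-mono-≤ {suc n} f≤g = +-mono-≤ (f≤g zero) (∑-mono-≤ (f≤g ∘ suc))

≤-∑ : ∀ {n} (f : Fin n → ℕ) i → f i ≤ ∑[ j < n ] f j
≤-∑ {suc n} f i = subst (f i ≤_) (sym (sum-remove {i = i} f)) (m≤m+n (f i) _)

∑-const : ∀ n c → ∑[ i < n ] c ≡ n * c
∑-const zero    c = refl
∑-const (suc n) c = cong (c +_) (∑-const n c)

∑∑-distrib-+ : ∀ {m n} (f g : Fin m → Fin n → ℕ) →
  ∑[ i < m ] ∑[ j < n ] (f i j + g i j) ≡ ∑[ i < m ] ∑[ j < n ] f i j + ∑[ i < m ] ∑[ j < n ] g i j
∑∑-distrib-+ {n = n} f g = trans
  (sum-cong-≗ (λ i → ∑-distrib-+ (f i) (g i)))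
  (∑-distrib-+ (λ i → ∑[ j < n ] f i j) (λ i → ∑[ j < n ] g i j))

∑-injective-≤ : ∀ {a m} (f : Fin m → ℕ) (g : Fin a → Fin m) → Injective _≡_ _≡_ g →
  ∑[ i < a ] f (g i) ≤ ∑[ j < m ] f j
∑-injective-≤ {zero}          f g g-inj = z≤n
∑-injective-≤ {suc a} {zero}  f g g-inj with () ← g zero
∑-injective-≤ {suc a} {suc m} f g g-inj = begin
  f g₀ + ∑[ i < a ] f (g (suc i))
    ≡⟨ cong (f g₀ +_) (sum-cong-≗ (cong f ∘ sym ∘ Finₚ.punchIn-punchOut ∘ g₀≢)) ⟩
  f g₀ + ∑[ i < a ] f (punchIn g₀ (g′ i))
    ≤⟨ +-monoʳ-≤ (f g₀) (∑-injective-≤ (f ∘ punchIn g₀) g′ g′-injective) ⟩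
  f g₀ + ∑[ j < m ] f (punchIn g₀ j)
    ≡⟨ sum-remove {i = g₀} f ⟨
  ∑[ j < suc m ] f j ∎
  where
  open ≤-Reasoning
  g₀ : Fin (suc m)
  g₀ = g zero
  g₀≢ : ∀ i → g₀ ≢ g (suc i)
  g₀≢ i = Finₚ.0≢1+n ∘ g-inj
  g′ : Fin a → Fin m
  g′ i = punchOut (g₀≢ i)
  g′-injective : Injective _≡_ _≡_ g′
  g′-injective e = Finₚ.suc-injective (g-inj (Finₚ.punchOut-injective (g₀≢ _) (g₀≢ _) e))

∑-both-orientations-≤ : ∀ {n} (f : Fin n → Fin n → ℕ) →
  ∑[ u < n ] ∑[ v < n ] (𝟙 (does (toℕ u <? toℕ v)) * (f u v + f v u)) ≤ ∑[ u < n ] ∑[ v < n ] f u v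
∑-both-orientations-≤ {n} f = begin
  ∑[ u < n ] ∑[ v < n ] (⟦ u ≺ v ⟧ * (f u v + f v u))
    ≡⟨ sum-cong-≗ (λ u → sum-cong-≗ (λ v → *-distribˡ-+ ⟦ u ≺ v ⟧ (f u v) (f v u))) ⟩
  ∑[ u < n ] ∑[ v < n ] (⟦ u ≺ v ⟧ * f u v + ⟦ u ≺ v ⟧ * f v u)
    ≡⟨ ∑∑-distrib-+ {n} {n} _ _ ⟩
  ∑[ u < n ] ∑[ v < n ] (⟦ u ≺ v ⟧ * f u v) + ∑[ u < n ] ∑[ v < n ] (⟦ u ≺ v ⟧ * f v u)
    ≡⟨ cong (∑[ u < n ] ∑[ v < n ] (⟦ u ≺ v ⟧ * f u v) +_) (∑-comm (λ u v → ⟦ u ≺ v ⟧ * f v u)) ⟩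
  ∑[ u < n ] ∑[ v < n ] (⟦ u ≺ v ⟧ * f u v) + ∑[ v < n ] ∑[ u < n ] (⟦ u ≺ v ⟧ * f v u)
    ≡⟨ ∑∑-distrib-+ {n} {n} _ _ ⟨
  ∑[ u < n ] ∑[ v < n ] (⟦ u ≺ v ⟧ * f u v + ⟦ v ≺ u ⟧ * f u v)
    ≤⟨ ∑-mono-≤ (λ u → ∑-mono-≤ (λ v → at-most-one (toℕ u <? toℕ v) (toℕ v <? toℕ u) (f u v))) ⟩
  ∑[ u < n ] ∑[ v < n ] f u v ∎
  where
  open ≤-Reasoning
  ⟦_≺_⟧ : Fin n → Fin n → ℕ
  ⟦ u ≺ v ⟧ = 𝟙 (does (toℕ u <? toℕ v))
  at-most-one : ∀ {i j} (i<j? : Dec (i < j)) (j<i? : Dec (j < i)) x →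
    𝟙 (does i<j?) * x + 𝟙 (does j<i?) * x ≤ x
  at-most-one (yes i<j) (yes j<i) x = contradiction j<i (<-asym i<j)
  at-most-one (yes _)   (no _)    x = ≤-reflexive (trans (+-identityʳ _) (+-identityʳ x))
  at-most-one (no _)    (yes _)   x = ≤-reflexive (+-identityʳ x)
  at-most-one (no _)    (no _)    x = z≤n

length-filterᵇ-filter : ∀ {a p} {A : Set a} {P : Pred A p} (b : A → Bool) (P? : Decidable P) xs →
  length (filterᵇ b (filter P? xs)) ≡ Listℕ.sum (map (λ x → 𝟙 (does (P? x) ∧ b x)) xs)
length-filterᵇ-filter b P? []       = refl
length-filterᵇ-filter b P? (x ∷ xs) with does (P? x)
... | false = length-filterᵇ-filter b P? xs
... | true with b x
...   | true  = cong suc (length-filterᵇ-filter b P? xs)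
...   | false = length-filterᵇ-filter b P? xs

sum-map-concatMap : ∀ {a b} {A : Set a} {B : Set b} (h : B → ℕ) (f : A → List B) xs →
  Listℕ.sum (map h (concatMap f xs)) ≡ Listℕ.sum (map (Listℕ.sum ∘ map h ∘ f) xs)
sum-map-concatMap h f []       = refl
sum-map-concatMap h f (x ∷ xs) = begin
  Listℕ.sum (map h (f x ++ concatMap f xs))
    ≡⟨ cong Listℕ.sum (map-++ h (f x) (concatMap f xs)) ⟩
  Listℕ.sum (map h (f x) ++ map h (concatMap f xs))
    ≡⟨ sum-++ (map h (f x)) (map h (concatMap f xs)) ⟩
  Listℕ.sum (map h (f x)) + Listℕ.sum (map h (concatMap f xs))
    ≡⟨ cong (Listℕ.sum (map h (f x)) +_) (sum-map-concatMap h f xs) ⟩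
  Listℕ.sum (map h (f x)) + Listℕ.sum (map (Listℕ.sum ∘ map h ∘ f) xs) ∎
  where open ≡-Reasoning

sum-tabulate : ∀ {n} (f : Fin n → ℕ) → Listℕ.sum (List.tabulate f) ≡ ∑[ i < n ] f i
sum-tabulate {zero}  f = refl
sum-tabulate {suc n} f = cong (f zero +_) (sum-tabulate (f ∘ suc))

sum-map-allFin : ∀ {n} (f : Fin n → ℕ) → Listℕ.sum (map f (allFin n)) ≡ ∑[ i < n ] f i
sum-map-allFin f = trans (cong Listℕ.sum (map-tabulate id f)) (sum-tabulate f)

sum-map-applyUpTo : ∀ (h f : ℕ → ℕ) m → Listℕ.sum (map h (applyUpTo f m)) ≡ ∑[ i < m ] h (f (toℕ i))
sum-map-applyUpTo h f zero    = refl
sum-map-applyUpTo h f (suc m) = cong (h (f 0) +_) (sum-map-applyUpTo h (f ∘ suc) m)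

edgeCount-∑ : ∀ {n} (a : Fin n → Fin n → Bool) →
  edgeCount a ≡ ∑[ u < n ] ∑[ v < n ] 𝟙 (does (toℕ u <? toℕ v) ∧ a u v)
edgeCount-∑ {n} a = begin
  edgeCount a                                             ≡⟨ length-filterᵇ-filter _ _ (concatMap row (allFin n)) ⟩
  Listℕ.sum (map edge (concatMap row (allFin n)))         ≡⟨ sum-map-concatMap edge row (allFin n) ⟩
  Listℕ.sum (map (Listℕ.sum ∘ map edge ∘ row) (allFin n)) ≡⟨ sum-map-allFin (Listℕ.sum ∘ map edge ∘ row) ⟩
  ∑[ u < n ] Listℕ.sum (map edge (row u))                 ≡⟨ sum-cong-≗ row-sum ⟩
  ∑[ u < n ] ∑[ v < n ] edge (u , v)                      ∎
  where
  open ≡-Reasoning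
  row : Fin n → List (Fin n × Fin n)
  row u = map (u ,_) (allFin n)
  edge : Fin n × Fin n → ℕ
  edge (u , v) = 𝟙 (does (toℕ u <? toℕ v) ∧ a u v)
  row-sum : ∀ u → Listℕ.sum (map edge (row u)) ≡ ∑[ v < n ] edge (u , v)
  row-sum u = trans (cong Listℕ.sum (sym (map-∘ (allFin n)))) (sum-map-allFin (λ v → edge (u , v)))

cvSum-∑ : ∀ {n} (a : Fin n → Fin n → Bool) → cvSum a ≡ ∑[ i < n ∸ 1 ] cv (suc (toℕ i)) a
cvSum-∑ {n} a = sum-map-applyUpTo (λ i → cv (suc i) a) id (n ∸ 1)

∈-tabulate⁺ : ∀ {n} {f : Fin n → Bool} {x} → f x ≡ true → x ∈ tabulate f
∈-tabulate⁺ {f = f} {x} fx = lookup⇒[]= x (tabulate f) (trans (lookup∘tabulate f x) fx)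

∈-tabulate⁻ : ∀ {n} {f : Fin n → Bool} {x} → x ∈ tabulate f → f x ≡ true
∈-tabulate⁻ {f = f} {x} x∈ = trans (sym (lookup∘tabulate f x)) ([]=⇒lookup x∈)

∣tabulate∣≡∑ : ∀ {n} (f : Fin n → Bool) → ∣ tabulate f ∣ ≡ ∑[ i < n ] 𝟙 (f i)
∣tabulate∣≡∑ {zero}  f = refl
∣tabulate∣≡∑ {suc n} f with f zero
... | true  = cong suc (∣tabulate∣≡∑ (f ∘ suc))
... | false = ∣tabulate∣≡∑ (f ∘ suc)

∉⇒lookup≡false : ∀ {n} {X : Subset n} {x} → x ∉ X → lookup X x ≡ false
∉⇒lookup≡false {X = X} {x} x∉X with lookup X x in eq
... | false = refl
... | true  = contradiction (lookup⇒[]= x X eq) x∉X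

∈-sn⁺ : ∀ {n} {X : Subset n} {a : Fin n → Fin n → Bool} {x} →
  x ∉ X → (∀ {v} → v ∈ X → a x v ≡ true) → x ∈ sn X a
∈-sn⁺ {n} {X} {a} {x} x∉X adjacent-to-X = ∈-tabulate⁺ (begin
  not (lookup X x) ∧ and (map seen (allFin n))
    ≡⟨ cong (λ b → not b ∧ and (map seen (allFin n))) (∉⇒lookup≡false x∉X) ⟩
  and (map seen (allFin n))
    ≡⟨ Equivalence.to T-≡ (all⁻ seen (All.universal adjacent (allFin n))) ⟩
  true ∎)
  where
  open ≡-Reasoning
  seen : Fin n → Bool
  seen v = not (lookup X v) ∨ a x v
  adjacent : ∀ v → T (seen v)
  adjacent v with lookup X v in eq
  ... | false = _
  ... | true  = Equivalence.from T-≡ (adjacent-to-X (lookup⇒[]= v X eq))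

sn⊆∁ : ∀ {n} (X : Subset n) (a : Fin n → Fin n → Bool) → sn X a ⊆ ∁ X
sn⊆∁ X a x∈sn = x∉p⇒x∈∁p λ x∈X → outside ([]=⇒lookup x∈X) (∈-tabulate⁻ x∈sn)
  where
  outside : ∀ {b c} → b ≡ true → not b ∧ c ≢ true
  outside refl ()

∣sn∣≤∸ : ∀ {n} (X : Subset n) (a : Fin n → Fin n → Bool) → ∣ sn X a ∣ ≤ n ∸ ∣ X ∣
∣sn∣≤∸ X a = ≤-trans (p⊆q⇒∣p∣≤∣q∣ (sn⊆∁ X a)) (≤-reflexive (∣∁p∣≡n∸∣p∣ X))

∈-allSubsets : ∀ {n} (X : Subset n) → X ∈ˡ allSubsets n
∈-allSubsets []                  = here refl
∈-allSubsets         (true ∷ X)  = ∈-++⁺ˡ (∈-map⁺ (true ∷_) (∈-allSubsets X))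
∈-allSubsets {suc n} (false ∷ X) = ∈-++⁺ʳ (map (true ∷_) (allSubsets n)) (∈-map⁺ (false ∷_) (∈-allSubsets X))

∣sn∣≤cv : ∀ {n} (X : Subset n) (a : Fin n → Fin n → Bool) → ∣ sn X a ∣ ≤ cv ∣ X ∣ a
∣sn∣≤cv {n} X a = foldr-preservesᵒ {P = ∣ sn X a ∣ ≤_} ≤-⊔ 0 _ (inj₂ (Any.map ≤-reflexive X-listed))
  where
  X-listed : ∣ sn X a ∣ ∈ˡ map (λ Y → ∣ sn Y a ∣) (filter (λ Y → ∣ Y ∣ ≟ ∣ X ∣) (allSubsets n))
  X-listed = ∈-map⁺ (λ Y → ∣ sn Y a ∣) (∈-filter⁺ (λ Y → ∣ Y ∣ ≟ ∣ X ∣) (∈-allSubsets X) refl)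
  ≤-⊔ : ∀ x y → ∣ sn X a ∣ ≤ x ⊎ ∣ sn X a ∣ ≤ y → ∣ sn X a ∣ ≤ x ⊔ y
  ≤-⊔ x y (inj₁ ≤x) = m≤n⇒m≤n⊔o y ≤x
  ≤-⊔ x y (inj₂ ≤y) = m≤n⇒m≤o⊔n x ≤y

cv≤∸ : ∀ {n} k (a : Fin n → Fin n → Bool) → cv k a ≤ n ∸ k
cv≤∸ {n} k a = foldr-preservesᵇ {P = _≤ n ∸ k} ⊔-lub z≤n
  (map⁺ (All.map (λ {Y} → λ { refl → ∣sn∣≤∸ Y a }) (all-filter (λ Y → ∣ Y ∣ ≟ k) (allSubsets n))))

∑-cv≤cvSum : ∀ {n} (a : Fin n → Fin n → Bool) → ∑[ i < n ] cv (suc (toℕ i)) a ≤ cvSum a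
∑-cv≤cvSum {zero}  a = z≤n
∑-cv≤cvSum {suc m} a = begin
  ∑[ i < suc m ] cv (suc (toℕ i)) a
    ≡⟨ sum-init-last (λ i → cv (suc (toℕ i)) a) ⟩
  ∑[ i < m ] cv (suc (toℕ (inject₁ i))) a + cv (suc (toℕ (fromℕ m))) a
    ≡⟨ cong₂ _+_ (sum-cong-≗ {m} (cong (λ j → cv (suc j) a) ∘ Finₚ.toℕ-inject₁))
                 (cong (λ j → cv (suc j) a) (Finₚ.toℕ-fromℕ m)) ⟩
  ∑[ i < m ] cv (suc (toℕ i)) a + cv (suc m) a
    ≤⟨ +-monoʳ-≤ _ (≤-trans (cv≤∸ (suc m) a) (≤-reflexive (n∸n≡0 m))) ⟩
  ∑[ i < m ] cv (suc (toℕ i)) a + 0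
    ≡⟨ +-identityʳ _ ⟩
  ∑[ i < m ] cv (suc (toℕ i)) a
    ≡⟨ cvSum-∑ a ⟨
  cvSum a ∎
  where open ≤-Reasoning

module Ranking {n} (key : Fin n → ℕ) (key-injective : Injective _≡_ _≡_ key) where

  below : Fin n → Subset n
  below u = tabulate (λ w → does (key w ≤? key u))

  ∈-below⁺ : ∀ {u w} → key w ≤ key u → w ∈ below u
  ∈-below⁺ {u} {w} = ∈-tabulate⁺ ∘ dec-true (key w ≤? key u)

  ∈-below⁻ : ∀ {u w} → w ∈ below u → key w ≤ key u
  ∈-below⁻ {u} {w} w∈ = ≤ᵇ⇒≤ (key w) (key u) (Equivalence.from T-≡ (∈-tabulate⁻ w∈))

  rank : Fin n → ℕ
  rank u = ∣ below u ∣

  rank-mono-< : ∀ {u v} → key u < key v → rank u < rank v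
  rank-mono-< {u} {v} ku<kv = p⊂q⇒∣p∣<∣q∣
    ( (λ w∈ → ∈-below⁺ (≤-trans (∈-below⁻ w∈) (<⇒≤ ku<kv)))
    , v , ∈-below⁺ ≤-refl , λ v∈ → <⇒≱ ku<kv (∈-below⁻ v∈))

  rank-injective : Injective _≡_ _≡_ rank
  rank-injective {u} {v} ru≡rv with <-cmp (key u) (key v)
  ... | tri< ku<kv _ _ = contradiction ru≡rv (<⇒≢ (rank-mono-< ku<kv))
  ... | tri≈ _ ku≡kv _ = key-injective ku≡kv
  ... | tri> _ _ kv<ku = contradiction (sym ru≡rv) (<⇒≢ (rank-mono-< kv<ku))

  rank-positive : ∀ u → 0 < rank u
  rank-positive u = subst (_≤ rank u) (∣⁅x⁆∣≡1 u) (p⊆q⇒∣p∣≤∣q∣ ⁅u⁆⊆below)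
    where
    ⁅u⁆⊆below : ⁅ u ⁆ ⊆ below u
    ⁅u⁆⊆below w∈ = subst (_∈ below u) (sym (x∈⁅y⁆⇒x≡y u w∈)) (∈-below⁺ ≤-refl)

  index : Fin n → Fin n
  index u = fromℕ< (subst (_≤ n) (sym (suc-pred (rank u) {{>-nonZero (rank-positive u)}})) (∣p∣≤n (below u)))

  suc-index : ∀ u → suc (toℕ (index u)) ≡ rank u
  suc-index u = trans (cong suc (Finₚ.toℕ-fromℕ< _)) (suc-pred (rank u) {{>-nonZero (rank-positive u)}})

  index-injective : Injective _≡_ _≡_ index
  index-injective {u} {v} iu≡iv = rank-injective (begin
    rank u              ≡⟨ suc-index u ⟨
    suc (toℕ (index u)) ≡⟨ cong (suc ∘ toℕ) iu≡iv ⟩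
    suc (toℕ (index v)) ≡⟨ suc-index v ⟩
    rank v              ∎)
    where open ≡-Reasoning

module IntervalSweep {n} (a : Fin n → Fin n → Bool) (l r : Fin n → ℕ) (l≤r : ∀ v → l v ≤ r v)
                     (disjoint⇒adjacent : ∀ {x v} → r v < l x → a x v ≡ true) where

  key : Fin n → ℕ
  key u = r u * n + toℕ u

  key-mono-< : ∀ {u v} → r u < r v → key u < key v
  key-mono-< {u} {v} ru<rv = begin-strict
    r u * n + toℕ u <⟨ +-monoʳ-< (r u * n) (Finₚ.toℕ<n u) ⟩
    r u * n + n     ≡⟨ +-comm (r u * n) n ⟩
    suc (r u) * n   ≤⟨ *-monoˡ-≤ n ru<rv ⟩
    r v * n         ≤⟨ m≤m+n (r v * n) (toℕ v) ⟩
    r v * n + toℕ v ∎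
    where open ≤-Reasoning

  key⁻¹-mono-≤ : ∀ {u v} → key u ≤ key v → r u ≤ r v
  key⁻¹-mono-≤ ku≤kv = ≮⇒≥ (λ rv<ru → <⇒≱ (key-mono-< rv<ru) ku≤kv)

  key-injective : Injective _≡_ _≡_ key
  key-injective {u} {v} ku≡kv with <-cmp (r u) (r v)
  ... | tri< ru<rv _ _ = contradiction ku≡kv (<⇒≢ (key-mono-< ru<rv))
  ... | tri≈ _ ru≡rv _ =
    Finₚ.toℕ-injective (+-cancelˡ-≡ (r v * n) _ _ (subst (λ m → m * n + toℕ u ≡ key v) ru≡rv ku≡kv))
  ... | tri> _ _ rv<ru = contradiction (sym ku≡kv) (<⇒≢ (key-mono-< rv<ru))

  open Ranking key key-injective

  after : Fin n → Subset n
  after u = tabulate (λ x → does (r u <? l x))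

  after⊆sn-below : ∀ u → after u ⊆ sn (below u) a
  after⊆sn-below u {x} x∈after = ∈-sn⁺ x∉below
    (λ v∈below → disjoint⇒adjacent (≤-<-trans (key⁻¹-mono-≤ (∈-below⁻ v∈below)) ru<lx))
    where
    ru<lx : r u < l x
    ru<lx = ≤ᵇ⇒≤ (suc (r u)) (l x) (Equivalence.from T-≡ (∈-tabulate⁻ x∈after))
    x∉below : x ∉ below u
    x∉below x∈below = <⇒≱ (<-≤-trans ru<lx (l≤r x)) (key⁻¹-mono-≤ (∈-below⁻ x∈below))

  ∑-after≤∑cv : ∑[ u < n ] ∑[ x < n ] 𝟙 (does (r u <? l x)) ≤ ∑[ i < n ] cv (suc (toℕ i)) a
  ∑-after≤∑cv = begin
    ∑[ u < n ] ∑[ x < n ] 𝟙 (does (r u <? l x)) ≡⟨ sum-cong-≗ (∣tabulate∣≡∑ ∘ λ u x → does (r u <? l x)) ⟨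
    ∑[ u < n ] ∣ after u ∣                     ≤⟨ ∑-mono-≤ (p⊆q⇒∣p∣≤∣q∣ ∘ after⊆sn-below) ⟩
    ∑[ u < n ] ∣ sn (below u) a ∣              ≤⟨ ∑-mono-≤ (λ u → ∣sn∣≤cv (below u) a) ⟩
    ∑[ u < n ] cv (rank u) a                   ≡⟨ sum-cong-≗ (cong (λ k → cv k a) ∘ suc-index) ⟨
    ∑[ u < n ] cv (suc (toℕ (index u))) a      ≤⟨ ∑-injective-≤ (λ i → cv (suc (toℕ i)) a) index index-injective ⟩
    ∑[ i < n ] cv (suc (toℕ i)) a              ∎
    where open ≤-Reasoning

complAdj-≡-not : ∀ {n} (G : SimpleGraph n) {u v} → u ≢ v → complAdj G u v ≡ not (adj G u v)
complAdj-≡-not G {u} {v} u≢v = cong (λ b → if b then false else not (adj G u v)) (dec-false (u ≟ᶠ v) u≢v)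

complAdj⇔nonadjacent : ∀ {n} (G : SimpleGraph n) {u v} → u ≢ v → complAdj G u v ≡ true ⇔ adj G u v ≢ true
complAdj⇔nonadjacent G u≢v rewrite complAdj-≡-not G u≢v = mk⇔
  (λ not-adj≡true adj≡true → not-¬ (sym adj≡true) (sym not-adj≡true))
  (λ adj≢true → sym (¬-not (adj≢true ∘ sym)))

¬overlap⇒disjoint : ∀ {lu ru lv rv} → ¬ (lu ≤ rv × lv ≤ ru) → ru < lv ⊎ rv < lu
¬overlap⇒disjoint {lu} {ru} {lv} {rv} ¬overlap with lu ≤? rv | lv ≤? ru
... | no lu≰rv  | _         = inj₂ (≰⇒> lu≰rv)
... | yes _     | no lv≰ru  = inj₁ (≰⇒> lv≰ru)
... | yes lu≤rv | yes lv≤ru = contradiction (lu≤rv , lv≤ru) ¬overlap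

module BoxRepresentation {n k} (G : SimpleGraph n) (box : BoxicityAtMost G k) where

  I : Fin k → SimpleGraph n
  I = proj₁ box

  l r : Fin k → Fin n → ℕ
  l j = proj₁ (proj₁ (proj₂ box) j)
  r j = proj₁ (proj₂ (proj₁ (proj₂ box) j))

  l≤r : ∀ j v → l j v ≤ r j v
  l≤r j = proj₁ (proj₂ (proj₂ (proj₁ (proj₂ box) j)))

  Iⱼ⇔overlap : ∀ j {u v} → u ≢ v → adj (I j) u v ≡ true ⇔ (l j u ≤ r j v × l j v ≤ r j u)
  Iⱼ⇔overlap j {u} {v} = proj₂ (proj₂ (proj₂ (proj₁ (proj₂ box) j))) u v

  G⇔⋂I : ∀ {u v} → u ≢ v → adj G u v ≡ true ⇔ (∀ j → adj (I j) u v ≡ true)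
  G⇔⋂I {u} {v} = proj₂ (proj₂ box) u v

  Gᶜ : Fin n → Fin n → Bool
  Gᶜ = complAdj G

  disjoint⇒complement-adjacent : ∀ j {x v} → r j v < l j x → Gᶜ x v ≡ true
  disjoint⇒complement-adjacent j {x} {v} rv<lx = Equivalence.from (complAdj⇔nonadjacent G x≢v) λ Gxv →
    <⇒≱ rv<lx (proj₁ (Equivalence.to (Iⱼ⇔overlap j x≢v) (Equivalence.to (G⇔⋂I x≢v) Gxv j)))
    where
    x≢v : x ≢ v
    x≢v refl = <⇒≱ rv<lx (l≤r j v)

  complement-adjacent⇒disjoint : ∀ {u v} → u ≢ v → Gᶜ u v ≡ true → ∃ λ j → r j u < l j v ⊎ r j v < l j u
  complement-adjacent⇒disjoint {u} {v} u≢v Gᶜuv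
    with Finₚ.¬∀⟶∃¬ k (λ j → adj (I j) u v ≡ true) (λ j → adj (I j) u v Bool.≟ true)
           (Equivalence.to (complAdj⇔nonadjacent G u≢v) Gᶜuv ∘ Equivalence.from (G⇔⋂I u≢v))
  ... | j , ¬Iⱼuv = j , ¬overlap⇒disjoint (¬Iⱼuv ∘ Equivalence.from (Iⱼ⇔overlap j u≢v))

  separation : Fin k → Fin n → Fin n → ℕ
  separation j u v = 𝟙 (does (r j u <? l j v))

  edge≤∑separations : ∀ u v → 𝟙 (does (toℕ u <? toℕ v) ∧ Gᶜ u v) ≤
    ∑[ j < k ] (𝟙 (does (toℕ u <? toℕ v)) * (separation j u v + separation j v u))
  edge≤∑separations u v = bound (toℕ u <? toℕ v)
    where
    bound : (u<v? : Dec (toℕ u < toℕ v)) →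
      𝟙 (does u<v? ∧ Gᶜ u v) ≤ ∑[ j < k ] (𝟙 (does u<v?) * (separation j u v + separation j v u))
    bound (no _) = z≤n
    bound (yes u<v) with Gᶜ u v in Gᶜuv
    ... | false = z≤n
    ... | true  with complement-adjacent⇒disjoint (λ { refl → <-irrefl refl u<v }) Gᶜuv
    ...   | j , disjoint = begin
      1                       ≤⟨ separated disjoint ⟩
      both j                  ≡⟨ *-identityˡ (both j) ⟨
      1 * both j              ≤⟨ ≤-∑ (λ i → 1 * both i) j ⟩
      ∑[ i < k ] (1 * both i) ∎
      where
      open ≤-Reasoning
      both : Fin k → ℕ
      both i = separation i u v + separation i v u
      separated : ∀ {j} → r j u < l j v ⊎ r j v < l j u → 1 ≤ separation j u v + separation j v u
      separated {j} (inj₁ ru<lv) rewrite 𝟙-yes (r j u <? l j v) ru<lv = m≤m+n 1 _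
      separated {j} (inj₂ rv<lu) rewrite 𝟙-yes (r j v <? l j u) rv<lu = m≤n+m 1 _

  edgeCount≤k*∑cv : edgeCount Gᶜ ≤ k * ∑[ i < n ] cv (suc (toℕ i)) Gᶜ
  edgeCount≤k*∑cv = begin
    edgeCount Gᶜ                                             ≡⟨ edgeCount-∑ Gᶜ ⟩
    ∑[ u < n ] ∑[ v < n ] 𝟙 (does (toℕ u <? toℕ v) ∧ Gᶜ u v) ≤⟨ ∑-mono-≤ (∑-mono-≤ ∘ edge≤∑separations) ⟩
    ∑[ u < n ] ∑[ v < n ] ∑[ j < k ] oriented j u v          ≡⟨ sum-cong-≗ (λ u → ∑-comm (λ v j → oriented j u v)) ⟩
    ∑[ u < n ] ∑[ j < k ] ∑[ v < n ] oriented j u v          ≡⟨ ∑-comm (λ u j → ∑[ v < n ] oriented j u v) ⟩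
    ∑[ j < k ] ∑[ u < n ] ∑[ v < n ] oriented j u v          ≤⟨ ∑-mono-≤ (∑-both-orientations-≤ ∘ separation) ⟩
    ∑[ j < k ] ∑[ u < n ] ∑[ v < n ] separation j u v        ≤⟨ ∑-mono-≤ sweep ⟩
    ∑[ j < k ] ∑[ i < n ] cv (suc (toℕ i)) Gᶜ                ≡⟨ ∑-const k _ ⟩
    k * ∑[ i < n ] cv (suc (toℕ i)) Gᶜ                       ∎
    where
    open ≤-Reasoning
    oriented : Fin k → Fin n → Fin n → ℕ
    oriented j u v = 𝟙 (does (toℕ u <? toℕ v)) * (separation j u v + separation j v u)
    sweep : ∀ j → ∑[ u < n ] ∑[ v < n ] separation j u v ≤ ∑[ i < n ] cv (suc (toℕ i)) Gᶜ
    sweep j = IntervalSweep.∑-after≤∑cv Gᶜ (l j) (r j) (l≤r j) (disjoint⇒complement-adjacent j)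

-- Non-completeness only lets the paper divide by the sum; the product form holds for every graph.
theorem2 : ∀ (n : ℕ) (G : SimpleGraph n) → NonComplete G →
    ∀ (k : ℕ) → BoxicityAtMost G k →
    edgeCount (complAdj G) ≤ k * cvSum (complAdj G)
theorem2 n G _ k box = ≤-trans edgeCount≤k*∑cv (*-monoʳ-≤ k (∑-cv≤cvSum (complAdj G)))
  where open BoxRepresentation G box
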